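{- The system $\mathbf{IntK_{\Box}}$ is a conservative extension of $\mathbf{MI_{\Box}}$: for every formula $\phi$ built from proposition letters, $\top$, $\wedge$, $\to$ and $\Box$, we have $\mathbf{IntK_{\Box}}\vdash\phi$ if and only if $\mathbf{MI_{\Box}}\vdash\phi$.
   Context: $\mathbf{MI_{\Box}}$ is derived by modus ponens from substitution instances of $p\to(q\to p)$, $(p\to(q\to r))\to((p\to q)\to(p\to r))$, $(p\wedge q)\to p$, $(p\wedge q)\to q$, $p\to(q\to(p\wedge q))$, $\top$, $\Box(p\wedge q)\leftrightarrow(\Box p\wedge\Box q)$, $\Box\top\leftrightarrow\top$, closed under the rule from $p\leftrightarrow q$ infer $\Box p\leftrightarrow\Box q$. $\mathbf{IntK_{\Box}}$ is the intuitionistic modal logic of Wolter and Zakharyaschev in the language of intuitionistic propositional logic with $\Box$; it proves $\Box(p\wedge q)\leftrightarrow(\Box p\wedge\Box q)$ and $\Box\top\leftrightarrow\top$, and it is sound and complete with respect to frames $(X,\leq,R)$ where $(X,\leq)$ is a poset and $R$ a relation with $R=({\leq}\circ R\circ{\leq})$ (where $x(R_1\circ R_2)z$ iff $\exists y$, $xR_1y$, $yR_2z$), with valuations assigning up-closed sets, intuitionistic connectives as in Kripke semantics and $x\Vdash\Box\phi$ iff every $y$ with $xRy$ satisfies $\phi$. -}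

module Defs where

open import Data.Nat using (ℕ)
open import Data.Product using (_×_)

data FmM : Set where
  var  : ℕ → FmM
  ⊤'   : FmM
  _∧'_ : FmM → FmM → FmM
  _⇒'_ : FmM → FmM → FmM
  □'_  : FmM → FmM

infixr 6 _∧'_
infixr 5 _⇒'_

_⇔'_ : FmM → FmM → FmM
p ⇔' q = (p ⇒' q) ∧' (q ⇒' p)

-- Hilbert system for MI□.  Axioms are given as schemata, i.e. all
-- substitution instances of the listed axioms.
data MI⊢_ : FmM → Set where
  ax-K    : ∀ p q → MI⊢ (p ⇒' (q ⇒' p))
  ax-S    : ∀ p q r → MI⊢ ((p ⇒' (q ⇒' r)) ⇒' ((p ⇒' q) ⇒' (p ⇒' r)))
  ax-∧E₁  : ∀ p q → MI⊢ ((p ∧' q) ⇒' p)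
  ax-∧E₂  : ∀ p q → MI⊢ ((p ∧' q) ⇒' q)
  ax-∧I   : ∀ p q → MI⊢ (p ⇒' (q ⇒' (p ∧' q)))
  ax-⊤    : MI⊢ ⊤'
  ax-□∧   : ∀ p q → MI⊢ ((□' (p ∧' q)) ⇔' ((□' p) ∧' (□' q)))
  ax-□⊤   : MI⊢ ((□' ⊤') ⇔' ⊤')
  mp      : ∀ {p q} → MI⊢ (p ⇒' q) → MI⊢ p → MI⊢ q
  re      : ∀ {p q} → MI⊢ (p ⇔' q) → MI⊢ ((□' p) ⇔' (□' q))

data Fm : Set where
  var  : ℕ → Fm
  ⊤ ⊥  : Fm
  _∧_  : Fm → Fm → Fm
  _∨_  : Fm → Fm → Fm
  _⇒_  : Fm → Fm → Fm
  □_   : Fm → Fm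

infixr 6 _∧_
infixr 6 _∨_
infixr 5 _⇒_

-- IntK□ (Wolter–Zakharyaschev): the smallest set containing Int and
-- □(p → q) → (□p → □q), closed under modus ponens, substitution and
-- necessitation.  Axioms are schemata (closure under substitution).
data IntK⊢_ : Fm → Set where
  ax-K    : ∀ p q → IntK⊢ (p ⇒ (q ⇒ p))
  ax-S    : ∀ p q r → IntK⊢ ((p ⇒ (q ⇒ r)) ⇒ ((p ⇒ q) ⇒ (p ⇒ r)))
  ax-∧E₁  : ∀ p q → IntK⊢ ((p ∧ q) ⇒ p)
  ax-∧E₂  : ∀ p q → IntK⊢ ((p ∧ q) ⇒ q)
  ax-∧I   : ∀ p q → IntK⊢ (p ⇒ (q ⇒ (p ∧ q)))
  ax-∨I₁  : ∀ p q → IntK⊢ (p ⇒ (p ∨ q))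
  ax-∨I₂  : ∀ p q → IntK⊢ (q ⇒ (p ∨ q))
  ax-∨E   : ∀ p q r → IntK⊢ ((p ⇒ r) ⇒ ((q ⇒ r) ⇒ ((p ∨ q) ⇒ r)))
  ax-⊥    : ∀ p → IntK⊢ (⊥ ⇒ p)
  ax-⊤    : IntK⊢ ⊤
  ax-□K   : ∀ p q → IntK⊢ ((□ (p ⇒ q)) ⇒ ((□ p) ⇒ (□ q)))
  mp      : ∀ {p q} → IntK⊢ (p ⇒ q) → IntK⊢ p → IntK⊢ q
  nec     : ∀ {p} → IntK⊢ p → IntK⊢ (□ p)

⌜_⌝ : FmM → Fm
⌜ var n ⌝  = var n
⌜ ⊤' ⌝     = ⊤
⌜ p ∧' q ⌝ = ⌜ p ⌝ ∧ ⌜ q ⌝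
⌜ p ⇒' q ⌝ = ⌜ p ⌝ ⇒ ⌜ q ⌝
⌜ □' p ⌝   = □ ⌜ p ⌝

{-# OPTIONS --safe #-}
-- MI□ ⊢ φ ⇒ IntK□ ⊢ φ is checked axiom by axiom.  For the converse, read the
-- full language in the Lindenbaum preorder of MI□: the worlds are fragment
-- formulas, y is later than x when MI□ ⊢ y → x, implication is interpreted
-- intuitionistically along this order, and x forces □ψ when MI□ ⊢ x → □c for
-- some c forcing ψ.  IntK□ is sound for this reading over any meet-semilattice
-- whose □ preserves finite meets, and on the fragment forcing at x coincides
-- with MI□ ⊢ x → φ.  Forcing at the world ⊤ then yields MI□ ⊢ φ.
module Submission where

open import Defs
open import Data.Nat using (ℕ)
open import Data.Product using (_×_; _,_; Σ-syntax)
open import Data.Sum using (_⊎_; inj₁; inj₂)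
open import Data.Unit using (tt) renaming (⊤ to Unit)
open import Data.Empty using () renaming (⊥ to Empty)
open import Function.Bundles using (_⇔_; mk⇔; Equivalence)

open Equivalence using (to; from)

module ProvableImplication
  {F : Set} (_⟶_ _&_ : F → F → F) (⊢_ : F → Set)
  (ax-K   : ∀ p q → ⊢ (p ⟶ (q ⟶ p)))
  (ax-S   : ∀ p q r → ⊢ ((p ⟶ (q ⟶ r)) ⟶ ((p ⟶ q) ⟶ (p ⟶ r))))
  (ax-∧E₁ : ∀ p q → ⊢ ((p & q) ⟶ p))
  (ax-∧E₂ : ∀ p q → ⊢ ((p & q) ⟶ q))
  (ax-∧I  : ∀ p q → ⊢ (p ⟶ (q ⟶ (p & q))))
  (mp     : ∀ {p q} → ⊢ (p ⟶ q) → ⊢ p → ⊢ q)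
  where

  infix 4 _≤_
  _≤_ : F → F → Set
  a ≤ b = ⊢ (a ⟶ b)

  ≤-refl : ∀ {a} → a ≤ a
  ≤-refl {a} = mp (mp (ax-S a (a ⟶ a) a) (ax-K a (a ⟶ a))) (ax-K a a)

  ⊢⇒≤ : ∀ {x c} → ⊢ c → x ≤ c
  ⊢⇒≤ {x} {c} d = mp (ax-K c x) d

  ≤-mp : ∀ {x a b} → x ≤ (a ⟶ b) → x ≤ a → x ≤ b
  ≤-mp {x} {a} {b} f g = mp (mp (ax-S x a b) f) g

  ≤-trans : ∀ {a b c} → a ≤ b → b ≤ c → a ≤ c
  ≤-trans f g = ≤-mp (⊢⇒≤ g) f

  &-greatest : ∀ {x a b} → x ≤ a → x ≤ b → x ≤ (a & b)
  &-greatest {x} {a} {b} f g = ≤-mp (≤-mp (⊢⇒≤ (ax-∧I a b)) f) g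

  ⟶-monoʳ : ∀ {a c d} → c ≤ d → (a ⟶ c) ≤ (a ⟶ d)
  ⟶-monoʳ {a} {c} {d} f = mp (ax-S a c d) (⊢⇒≤ f)

  ≤-curry : ∀ {x a b} → (x & a) ≤ b → x ≤ (a ⟶ b)
  ≤-curry {x} {a} {b} f = ≤-trans (ax-∧I x a) (⟶-monoʳ f)

  ≤-antisym : ∀ {a b} → a ≤ b → b ≤ a → ⊢ ((a ⟶ b) & (b ⟶ a))
  ≤-antisym {a} {b} f g = mp (mp (ax-∧I (a ⟶ b) (b ⟶ a)) f) g

  iff⇒≤ : ∀ {a b} → ⊢ ((a ⟶ b) & (b ⟶ a)) → a ≤ b
  iff⇒≤ {a} {b} d = mp (ax-∧E₁ (a ⟶ b) (b ⟶ a)) d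

  iff⇒≥ : ∀ {a b} → ⊢ ((a ⟶ b) & (b ⟶ a)) → b ≤ a
  iff⇒≥ {a} {b} d = mp (ax-∧E₂ (a ⟶ b) (b ⟶ a)) d

module IntK = ProvableImplication _⇒_ _∧_ IntK⊢_ ax-K ax-S ax-∧E₁ ax-∧E₂ ax-∧I mp

□-mono-IntK : ∀ {a b} → IntK⊢ (a ⇒ b) → IntK⊢ (□ a ⇒ □ b)
□-mono-IntK {a} {b} a⇒b = mp (ax-□K a b) (nec a⇒b)

embed-⊢ : ∀ {φ} → MI⊢ φ → IntK⊢ ⌜ φ ⌝
embed-⊢ (ax-K p q)   = ax-K _ _
embed-⊢ (ax-S p q r) = ax-S _ _ _
embed-⊢ (ax-∧E₁ p q) = ax-∧E₁ _ _
embed-⊢ (ax-∧E₂ p q) = ax-∧E₂ _ _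
embed-⊢ (ax-∧I p q)  = ax-∧I _ _
embed-⊢ ax-⊤         = ax-⊤
embed-⊢ (ax-□∧ p q)  = ≤-antisym □-∧-split □-∧-join
  where
  open IntK using (⊢⇒≤; ≤-mp; ≤-trans; &-greatest; ≤-antisym)
  P = ⌜ p ⌝
  Q = ⌜ q ⌝
  □-∧-split : IntK⊢ (□ (P ∧ Q) ⇒ □ P ∧ □ Q)
  □-∧-split = &-greatest (□-mono-IntK (ax-∧E₁ P Q)) (□-mono-IntK (ax-∧E₂ P Q))
  □-∧-join : IntK⊢ (□ P ∧ □ Q ⇒ □ (P ∧ Q))
  □-∧-join = ≤-mp (≤-mp (⊢⇒≤ (ax-□K Q (P ∧ Q)))
                     (≤-trans (ax-∧E₁ (□ P) (□ Q)) (□-mono-IntK (ax-∧I P Q))))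
                 (ax-∧E₂ (□ P) (□ Q))
embed-⊢ ax-□⊤        = IntK.≤-antisym (IntK.⊢⇒≤ ax-⊤) (IntK.⊢⇒≤ (nec ax-⊤))
embed-⊢ (mp d e)     = mp (embed-⊢ d) (embed-⊢ e)
embed-⊢ (re d)       =
  IntK.≤-antisym (□-mono-IntK (IntK.iff⇒≤ (embed-⊢ d))) (□-mono-IntK (IntK.iff⇒≥ (embed-⊢ d)))

record BoxedMeetSemilattice : Set₁ where
  infix 4 _≤_
  infixr 6 _⊓_
  field
    Carrier    : Set
    _≤_        : Carrier → Carrier → Set
    ≤-refl     : ∀ {a} → a ≤ a
    ≤-trans    : ∀ {a b c} → a ≤ b → b ≤ c → a ≤ c
    _⊓_        : Carrier → Carrier → Carrier
    ⊓-lowerˡ   : ∀ a b → a ⊓ b ≤ a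
    ⊓-lowerʳ   : ∀ a b → a ⊓ b ≤ b
    ⊓-greatest : ∀ {x a b} → x ≤ a → x ≤ b → x ≤ a ⊓ b
    top        : Carrier
    ≤-top      : ∀ {a} → a ≤ top
    ■          : Carrier → Carrier
    ■-⊓        : ∀ a b → ■ a ⊓ ■ b ≤ ■ (a ⊓ b)
    ■-top      : top ≤ ■ top

module DownsetSemantics (A : BoxedMeetSemilattice) (v : ℕ → BoxedMeetSemilattice.Carrier A) where
  open BoxedMeetSemilattice A

  ⟦_⟧ : Fm → Carrier → Set
  ⟦ var n ⟧ x = x ≤ v n
  ⟦ ⊤ ⟧     x = Unit
  ⟦ ⊥ ⟧     x = Empty
  ⟦ p ∧ q ⟧ x = ⟦ p ⟧ x × ⟦ q ⟧ x
  ⟦ p ∨ q ⟧ x = ⟦ p ⟧ x ⊎ ⟦ q ⟧ x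
  ⟦ p ⇒ q ⟧ x = ∀ y → y ≤ x → ⟦ p ⟧ y → ⟦ q ⟧ y
  ⟦ □ p ⟧   x = Σ[ c ∈ Carrier ] ⟦ p ⟧ c × x ≤ ■ c

  ⟦⟧-antitone : ∀ φ {x y} → y ≤ x → ⟦ φ ⟧ x → ⟦ φ ⟧ y
  ⟦⟧-antitone (var n) y≤x s         = ≤-trans y≤x s
  ⟦⟧-antitone ⊤       y≤x _         = tt
  ⟦⟧-antitone (p ∧ q) y≤x (s , t)   = ⟦⟧-antitone p y≤x s , ⟦⟧-antitone q y≤x t
  ⟦⟧-antitone (p ∨ q) y≤x (inj₁ s)  = inj₁ (⟦⟧-antitone p y≤x s)
  ⟦⟧-antitone (p ∨ q) y≤x (inj₂ t)  = inj₂ (⟦⟧-antitone q y≤x t)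
  ⟦⟧-antitone (p ⇒ q) y≤x f         = λ z z≤y → f z (≤-trans z≤y y≤x)
  ⟦⟧-antitone (□ p)   y≤x (c , s , x≤■c) = c , s , ≤-trans y≤x x≤■c

  -- A meet of two witnesses for □(p → q) and □p witnesses □q.
  □K-valid : ∀ p q x → ⟦ □ (p ⇒ q) ⇒ (□ p ⇒ □ q) ⟧ x
  □K-valid p q x y _ (c , f , y≤■c) z z≤y (d , s , z≤■d) =
    c ⊓ d ,
    f (c ⊓ d) (⊓-lowerˡ c d) (⟦⟧-antitone p (⊓-lowerʳ c d) s) ,
    ≤-trans (⊓-greatest (≤-trans z≤y y≤■c) z≤■d) (■-⊓ c d)

  sound : ∀ {φ} → IntK⊢ φ → ∀ x → ⟦ φ ⟧ x
  sound (ax-K p q) x y _ s z z≤y _ = ⟦⟧-antitone p z≤y s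
  sound (ax-S p q r) x y _ f z z≤y g w w≤z s =
    f w (≤-trans w≤z z≤y) s w ≤-refl (g w w≤z s)
  sound (ax-∧E₁ p q) x y _ (s , _) = s
  sound (ax-∧E₂ p q) x y _ (_ , t) = t
  sound (ax-∧I p q) x y _ s z z≤y t = ⟦⟧-antitone p z≤y s , t
  sound (ax-∨I₁ p q) x y _ s = inj₁ s
  sound (ax-∨I₂ p q) x y _ t = inj₂ t
  sound (ax-∨E p q r) x y _ f z z≤y g w w≤z (inj₁ s) = f w (≤-trans w≤z z≤y) s
  sound (ax-∨E p q r) x y _ f z z≤y g w w≤z (inj₂ t) = g w w≤z t
  sound (ax-⊥ p) x y _ ()
  sound ax-⊤ x = tt
  sound (ax-□K p q) x = □K-valid p q x
  sound (mp d e) x = sound d x x ≤-refl (sound e x)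
  sound (nec d) x = top , sound d top , ≤-trans ≤-top ■-top

module MI = ProvableImplication _⇒'_ _∧'_ MI⊢_ ax-K ax-S ax-∧E₁ ax-∧E₂ ax-∧I mp

open MI using (_≤_; ≤-refl; ≤-trans; ⊢⇒≤; ≤-mp; &-greatest; ≤-curry; ≤-antisym; iff⇒≤; iff⇒≥)

□'-mono : ∀ {a b} → a ≤ b → □' a ≤ □' b
□'-mono {a} {b} a≤b =
  ≤-trans (iff⇒≤ (re (≤-antisym (&-greatest ≤-refl a≤b) (ax-∧E₁ a b))))
    (≤-trans (iff⇒≤ (ax-□∧ a b)) (ax-∧E₂ (□' a) (□' b)))

lindenbaum : BoxedMeetSemilattice
lindenbaum = record
  { Carrier    = FmM
  ; _≤_        = _≤_
  ; ≤-refl     = ≤-refl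
  ; ≤-trans    = ≤-trans
  ; _⊓_        = _∧'_
  ; ⊓-lowerˡ   = ax-∧E₁
  ; ⊓-lowerʳ   = ax-∧E₂
  ; ⊓-greatest = &-greatest
  ; top        = ⊤'
  ; ≤-top      = ⊢⇒≤ ax-⊤
  ; ■          = □'_
  ; ■-⊓        = λ a b → iff⇒≥ (ax-□∧ a b)
  ; ■-top      = iff⇒≥ ax-□⊤
  }

open DownsetSemantics lindenbaum var

truth-lemma : ∀ φ {x} → ⟦ ⌜ φ ⌝ ⟧ x ⇔ x ≤ φ
truth-lemma (var n) = mk⇔ (λ s → s) (λ s → s)
truth-lemma ⊤'      = mk⇔ (λ _ → ⊢⇒≤ ax-⊤) (λ _ → tt)
truth-lemma (p ∧' q) = mk⇔
  (λ (s , t) → &-greatest (to (truth-lemma p) s) (to (truth-lemma q) t))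
  (λ x≤p∧q → from (truth-lemma p) (≤-trans x≤p∧q (ax-∧E₁ p q)) ,
             from (truth-lemma q) (≤-trans x≤p∧q (ax-∧E₂ p q)))
truth-lemma (p ⇒' q) {x} = mk⇔
  (λ f → ≤-curry (to (truth-lemma q)
           (f (x ∧' p) (ax-∧E₁ x p) (from (truth-lemma p) (ax-∧E₂ x p)))))
  (λ x≤p⇒q y y≤x s → from (truth-lemma q) (≤-mp (≤-trans y≤x x≤p⇒q) (to (truth-lemma p) s)))
truth-lemma (□' p) = mk⇔
  (λ (c , s , x≤□c) → ≤-trans x≤□c (□'-mono (to (truth-lemma p) s)))
  (λ x≤□p → p , from (truth-lemma p) ≤-refl , x≤□p)

theorem6p5 : (φ : FmM) → ((IntK⊢ ⌜ φ ⌝ → MI⊢ φ) × (MI⊢ φ → IntK⊢ ⌜ φ ⌝))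
theorem6p5 φ = conservative , embed-⊢
  where
  conservative : IntK⊢ ⌜ φ ⌝ → MI⊢ φ
  conservative d = mp (to (truth-lemma φ) (sound d ⊤')) ax-⊤
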